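{- A bipartite quiver $Q$ is recurrent if and only if the adjacency matrices $A_{\Gamma(Q)}$ and $A_{\Delta(Q)}$ of the associated bipartite bigraph $G(Q)=(\Gamma(Q),\Delta(Q))$ commute.
   Context: A quiver is a finite directed graph without loops and directed 2-cycles. Mutation $\mu_v$: for each pair of arrows $u\to v$, $v\to w$ add an arrow $u\to w$; reverse all arrows incident to $v$; then repeatedly remove both arrows of any directed 2-cycle. $Q$ is bipartite with bipartition $\epsilon:\mathrm{Vert}(Q)\to\{0,1\}$; $\epsilon=1$ vertices black, $\epsilon=0$ white; $\mu_\bullet$ (resp. $\mu_\circ$) is the composition of mutations at all black (resp. white) vertices; $Q$ is recurrent if each of $\mu_\bullet(Q)$, $\mu_\circ(Q)$ equals $Q$ with all arrows reversed. The bigraph $G(Q)$ consists of two undirected graphs on $\mathrm{Vert}(Q)$: $\Gamma(Q)$ has an edge $\{u,v\}$ for each arrow $u\to v$ of $Q$ with $\epsilon_u=0,\epsilon_v=1$, and $\Delta(Q)$ has an edge $\{u,v\}$ for each arrow $u\to v$ with $\epsilon_u=1,\epsilon_v=0$. -}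

module Defs where

open import Data.Nat using (ℕ; zero; suc; _+_; _*_; _∸_; _<_)
open import Data.Bool using (Bool; true; false; if_then_else_; not)
open import Data.Fin using (Fin; _≟_)
open import Data.List using (List; foldr; map)
open import Data.Nat.ListAction using (sum)
open import Data.List using () renaming (allFin to allFinL)
open import Relation.Nullary using (¬_; does)
open import Relation.Binary.PropositionalEquality using (_≡_)
open import Data.Product using (_×_)

-- A quiver on vertex set Fin n is given by its arrow multiplicities:
-- arrows u v = number of arrows u → v.
Arrows : ℕ → Set
Arrows n = Fin n → Fin n → ℕ

IsQuiver : {n : ℕ} → Arrows n → Set
IsQuiver {n} b = ((i : Fin n) → b i i ≡ 0) ×
                 ((i j : Fin n) → b i j ≡ 0 ⊎' b j i ≡ 0)
  where
  open import Data.Sum using () renaming (_⊎_ to _⊎'_)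

-- Mutation at v:
--  * for each pair of arrows u → v, v → w add an arrow u → w
--    (b u v * b v w new arrows);
--  * reverse all arrows incident to v;
--  * cancel directed 2-cycles (net multiplicity).
mutate : {n : ℕ} → Fin n → Arrows n → Arrows n
mutate v b u w =
  if does (u ≟ v) then b w u else
  if does (w ≟ v) then b w u else
  ((b u w + b u v * b v w) ∸ (b w u + b w v * b v u))

-- Bipartition ε : Fin n → Bool (true = ε 1 = black, false = ε 0 = white);
-- every arrow joins vertices of different colours.
IsBipartite : {n : ℕ} → Arrows n → (Fin n → Bool) → Set
IsBipartite {n} b ε = (i j : Fin n) → 0 < b i j → ¬ (ε i ≡ ε j)

mutateColour : {n : ℕ} → (Fin n → Bool) → Bool → Arrows n → Arrows n
mutateColour {n} ε c b =
  foldr (λ v acc → if does (Data.Bool._≟_ (ε v) c) then mutate v acc else acc)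
        b (allFinL n)
  where import Data.Bool

μ● : {n : ℕ} → (Fin n → Bool) → Arrows n → Arrows n
μ● ε = mutateColour ε true

μ○ : {n : ℕ} → (Fin n → Bool) → Arrows n → Arrows n
μ○ ε = mutateColour ε false

opposite : {n : ℕ} → Arrows n → Arrows n
opposite b u w = b w u

EqArrows : {n : ℕ} → Arrows n → Arrows n → Set
EqArrows {n} b c = (i j : Fin n) → b i j ≡ c i j

Recurrent : {n : ℕ} → Arrows n → (Fin n → Bool) → Set
Recurrent b ε = EqArrows (μ● ε b) (opposite b) × EqArrows (μ○ ε b) (opposite b)

-- Adjacency matrices of the bigraph G(Q) = (Γ(Q), Δ(Q)).
-- Γ has an edge {u,v} per arrow u → v with ε u = 0 (white), ε v = 1 (black);
-- Δ has an edge {u,v} per arrow u → v with ε u = 1 (black), ε v = 0 (white).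
edgesΓ : {n : ℕ} → Arrows n → (Fin n → Bool) → Fin n → Fin n → ℕ
edgesΓ b ε u v = if not (ε u) then (if ε v then b u v else 0) else 0

edgesΔ : {n : ℕ} → Arrows n → (Fin n → Bool) → Fin n → Fin n → ℕ
edgesΔ b ε u v = if ε u then (if not (ε v) then b u v else 0) else 0

adjΓ : {n : ℕ} → Arrows n → (Fin n → Bool) → Fin n → Fin n → ℕ
adjΓ b ε u v = edgesΓ b ε u v + edgesΓ b ε v u

adjΔ : {n : ℕ} → Arrows n → (Fin n → Bool) → Fin n → Fin n → ℕ
adjΔ b ε u v = edgesΔ b ε u v + edgesΔ b ε v u

matMul : {n : ℕ} → (Fin n → Fin n → ℕ) → (Fin n → Fin n → ℕ) → Fin n → Fin n → ℕ
matMul {n} A B i j = sum (map (λ k → A i k * B k j) (allFinL n))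

Commute : {n : ℕ} → (Fin n → Fin n → ℕ) → (Fin n → Fin n → ℕ) → Set
Commute {n} A B = (i j : Fin n) → matMul A B i j ≡ matMul B A i j

module Submission where

-- The vertices of one colour c form an independent set R, and
-- mutating successively at the vertices of an independent set has a closed
-- form: arrows at a vertex of R are reversed, and between two vertices u, w
-- outside R the net number of arrows u → w becomes
--   (#paths u → k → w, k ∈ R) + b u w  ∸  (#paths w → k → u, k ∈ R) + b w u.
-- For a bipartite quiver the two vertices outside the colour class have the
-- same colour, so b u w = b w u = 0, and μ_c Q = Q^op holds exactly when the
-- two-step path counts through the colour class c are symmetric.
-- On the other side, (A_Γ A_Δ) i j counts the two-step paths i → k → j
-- through a black k when i, j are white, the paths j → k → i through a white
-- k when i, j are black, and is 0 otherwise; moreover A_Δ A_Γ is the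
-- transpose of A_Γ A_Δ.  Hence commutation is the same pair of symmetry
-- conditions.

open import Defs
open import Data.Nat using (ℕ; zero; suc; _+_; _*_; _∸_; _<_; z<s)
open import Data.Nat.Properties
  using (+-comm; +-assoc; +-identityʳ; *-comm; *-zeroʳ; 0∸n≡0; n∸n≡0; m∸n≡0⇒m≤n; ≤-antisym)
open import Data.Nat.ListAction using (sum)
open import Data.Bool using (Bool; true; false; not; if_then_else_)
open import Data.Bool.Properties using (¬-not; not-¬)
import Data.Bool as Bool
open import Data.Fin using (Fin; _≟_)
open import Data.List using (List; []; _∷_; foldr; map; filter; allFin)
open import Data.List.Properties using (map-cong)
open import Data.List.Relation.Unary.Any using (here; there; tail)
open import Data.List.Relation.Unary.All.Properties using (All¬⇒¬Any)
open import Data.List.Relation.Unary.AllPairs using (_∷_)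
open import Data.List.Relation.Unary.Unique.Propositional using (Unique)
open import Data.List.Relation.Unary.Unique.Propositional.Properties using (allFin⁺; filter⁺)
open import Data.List.Membership.Propositional using (_∈_; _∉_)
open import Data.List.Membership.Propositional.Properties using (∈-allFin; ∈-filter⁺; ∈-filter⁻)
open import Data.Sum using (_⊎_; inj₁; inj₂; [_,_]; swap)
import Data.Sum as Sum
open import Data.Product using (_×_; _,_; proj₂)
open import Data.Product.Function.NonDependent.Propositional using (_×-⇔_)
open import Data.Empty using (⊥-elim)
open import Relation.Nullary using (¬_; Dec; yes; no; does)
open import Relation.Unary using (Pred; Decidable)
open import Relation.Binary.PropositionalEquality using (_≡_; refl; sym; trans; cong; cong₂; subst; module ≡-Reasoning)
open import Function.Bundles using (_⇔_; mk⇔)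
import Function.Properties.Equivalence as ⇔

∸-one-zero : ∀ {x y} → x ≡ 0 ⊎ y ≡ 0 → x ∸ y ≡ x
∸-one-zero {y = y} (inj₁ refl) = 0∸n≡0 y
∸-one-zero         (inj₂ refl) = refl

-- A truncated difference x ∸ y paired with y ∸ x remembers the integer
-- x - y, so adding further amounts p, q and truncating again is the same
-- as truncating once.  This is how successive mutations compose.
∸-recompose : ∀ x y p q → ((x ∸ y) + p) ∸ ((y ∸ x) + q) ≡ (x + p) ∸ (y + q)
∸-recompose zero    zero    p q = refl
∸-recompose zero    (suc y) p q = refl
∸-recompose (suc x) zero    p q = refl
∸-recompose (suc x) (suc y) p q = ∸-recompose x y p q

∸-both-zero : ∀ {x y} → x ∸ y ≡ 0 → y ∸ x ≡ 0 → x ≡ y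
∸-both-zero x∸y≡0 y∸x≡0 = ≤-antisym (m∸n≡0⇒m≤n x∸y≡0) (m∸n≡0⇒m≤n y∸x≡0)

module _ {a} {A : Set a} where

  sum-vanishes : (f : A → ℕ) (L : List A) → (∀ {k} → k ∈ L → f k ≡ 0) → sum (map f L) ≡ 0
  sum-vanishes f []      _  = refl
  sum-vanishes f (x ∷ L) f0 = cong₂ _+_ (f0 (here refl)) (sum-vanishes f L (λ k∈L → f0 (there k∈L)))

  sum-filter : ∀ {p} {P : Pred A p} (P? : Decidable P) (f : A → ℕ) (L : List A) →
    sum (map f (filter P? L)) ≡ sum (map (λ x → if does (P? x) then f x else 0) L)
  sum-filter P? f []      = refl
  sum-filter P? f (x ∷ L) with does (P? x)
  ... | true  = cong (f x +_) (sum-filter P? f L)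
  ... | false = sum-filter P? f L

  foldr-filter : ∀ {b p} {B : Set b} {P : Pred A p} (P? : Decidable P) (f : A → B → B) (z : B) (L : List A) →
    foldr (λ x acc → if does (P? x) then f x acc else acc) z L ≡ foldr f z (filter P? L)
  foldr-filter P? f z []      = refl
  foldr-filter P? f z (x ∷ L) with does (P? x)
  ... | true  = cong (f x) (foldr-filter P? f z L)
  ... | false = foldr-filter P? f z L

module _ {n : ℕ} (v : Fin n) (s : Arrows n) where

  mutate-at : ∀ {u w} → u ≡ v ⊎ w ≡ v → mutate v s u w ≡ s w u
  mutate-at {u} {w} at with u ≟ v
  ... | yes _ = refl
  ... | no u≢v with w ≟ v
  ...   | yes _   = refl
  ...   | no w≢v = ⊥-elim ([ u≢v , w≢v ] at)

  mutate-away : ∀ {u w} → ¬ u ≡ v → ¬ w ≡ v →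
    mutate v s u w ≡ (s u w + s u v * s v w) ∸ (s w u + s w v * s v u)
  mutate-away {u} {w} u≢v w≢v with u ≟ v
  ... | yes u≡v = ⊥-elim (u≢v u≡v)
  ... | no _ with w ≟ v
  ...   | yes w≡v = ⊥-elim (w≢v w≡v)
  ...   | no _    = refl

paths : {n : ℕ} → Arrows n → List (Fin n) → Fin n → Fin n → ℕ
paths b R u w = sum (map (λ k → b u k * b k w) R)

module IndependentMutation {n : ℕ} (b : Arrows n) (no-2-cycle : ∀ u w → b u w ≡ 0 ⊎ b w u ≡ 0) where

  open import Data.List.Membership.DecPropositional (_≟_ {n}) using (_∈?_)

  Independent : List (Fin n) → Set
  Independent R = ∀ {u w} → u ∈ R → w ∈ R → b u w ≡ 0

  record MutatedAlong (R : List (Fin n)) (s : Arrows n) : Set where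
    field
      reversed : ∀ u w → u ∈ R ⊎ w ∈ R → s u w ≡ b w u
      composed : ∀ u w → u ∉ R → w ∉ R →
                 s u w ≡ (paths b R u w + b u w) ∸ (paths b R w u + b w u)

  mutated-along-nothing : MutatedAlong [] b
  mutated-along-nothing = record
    { reversed = λ { _ _ (inj₁ ()) ; _ _ (inj₂ ()) }
    ; composed = λ u w _ _ → sym (∸-one-zero (no-2-cycle u w)) }

  mutated-along-step : ∀ {v R s} → v ∉ R → Independent (v ∷ R) →
    MutatedAlong R s → MutatedAlong (v ∷ R) (mutate v s)
  mutated-along-step {v} {R} {s} v∉R indep M = record { reversed = reversed′ ; composed = composed′ }
    where
    open MutatedAlong M

    no-path-to-v : ∀ u → paths b R u v ≡ 0
    no-path-to-v u = sum-vanishes _ R λ {k} k∈R →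
      trans (cong (b u k *_) (indep (there k∈R) (here refl))) (*-zeroʳ (b u k))

    no-path-from-v : ∀ w → paths b R v w ≡ 0
    no-path-from-v w = sum-vanishes _ R (λ k∈R → cong (_* b _ w) (indep (here refl) (there k∈R)))

    -- v is not yet mutated, so the arrows at v are still those of b
    fresh-in : ∀ u → s u v ≡ b u v
    fresh-in u with u ∈? R
    ... | yes u∈R = trans (reversed u v (inj₁ u∈R))
                          (trans (indep (here refl) (there u∈R)) (sym (indep (there u∈R) (here refl))))
    ... | no u∉R = begin
      s u v                                        ≡⟨ composed u v u∉R v∉R ⟩
      (paths b R u v + b u v) ∸ (paths b R v u + b v u) ≡⟨ cong₂ (λ x y → (x + b u v) ∸ (y + b v u)) (no-path-to-v u) (no-path-from-v u) ⟩
      b u v ∸ b v u                                ≡⟨ ∸-one-zero (no-2-cycle u v) ⟩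
      b u v                                        ∎
      where open ≡-Reasoning

    fresh-out : ∀ w → s v w ≡ b v w
    fresh-out w with w ∈? R
    ... | yes w∈R = trans (reversed v w (inj₂ w∈R))
                          (trans (indep (there w∈R) (here refl)) (sym (indep (here refl) (there w∈R))))
    ... | no w∉R = begin
      s v w                                        ≡⟨ composed v w v∉R w∉R ⟩
      (paths b R v w + b v w) ∸ (paths b R w v + b w v) ≡⟨ cong₂ (λ x y → (x + b v w) ∸ (y + b w v)) (no-path-from-v w) (no-path-to-v w) ⟩
      b v w ∸ b w v                                ≡⟨ ∸-one-zero (no-2-cycle v w) ⟩
      b v w                                        ∎
      where open ≡-Reasoning

    detour : ∀ {u w} → ¬ u ≡ v → ¬ w ≡ v →
      mutate v s u w ≡ (s u w + b u v * b v w) ∸ (s w u + b w v * b v u)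
    detour {u} {w} u≢v w≢v = trans (mutate-away v s u≢v w≢v)
      (cong₂ (λ p q → (s u w + p) ∸ (s w u + q))
             (cong₂ _*_ (fresh-in u) (fresh-out w)) (cong₂ _*_ (fresh-in w) (fresh-out u)))

    no-detour : ∀ {u w} → u ∈ R ⊎ w ∈ R → b u v * b v w ≡ 0
    no-detour {u} {w} (inj₁ u∈R) = cong (_* b v w) (indep (there u∈R) (here refl))
    no-detour {u} {w} (inj₂ w∈R) = trans (cong (b u v *_) (indep (here refl) (there w∈R))) (*-zeroʳ (b u v))

    reversed′ : ∀ u w → u ∈ v ∷ R ⊎ w ∈ v ∷ R → mutate v s u w ≡ b w u
    reversed′ u w in-R = by-cases (u ≟ v) (w ≟ v)
      where
      open ≡-Reasoning
      by-cases : Dec (u ≡ v) → Dec (w ≡ v) → mutate v s u w ≡ b w u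
      by-cases (yes u≡v) _ =
        trans (mutate-at v s (inj₁ u≡v)) (subst (λ x → s w x ≡ b w x) (sym u≡v) (fresh-in w))
      by-cases (no _) (yes w≡v) =
        trans (mutate-at v s (inj₂ w≡v)) (subst (λ x → s x u ≡ b x u) (sym w≡v) (fresh-out u))
      by-cases (no u≢v) (no w≢v) = begin
        mutate v s u w                                    ≡⟨ detour u≢v w≢v ⟩
        (s u w + b u v * b v w) ∸ (s w u + b w v * b v u)  ≡⟨ cong₂ (λ x y → (x + b u v * b v w) ∸ (y + b w v * b v u))
                                                                  (reversed u w in-R′) (reversed w u (swap in-R′)) ⟩
        (b w u + b u v * b v w) ∸ (b u w + b w v * b v u)  ≡⟨ cong₂ (λ p q → (b w u + p) ∸ (b u w + q))
                                                                  (no-detour in-R′) (no-detour (swap in-R′)) ⟩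
        (b w u + 0) ∸ (b u w + 0)                          ≡⟨ cong₂ _∸_ (+-identityʳ (b w u)) (+-identityʳ (b u w)) ⟩
        b w u ∸ b u w                                     ≡⟨ ∸-one-zero (no-2-cycle w u) ⟩
        b w u                                             ∎
        where
        in-R′ : u ∈ R ⊎ w ∈ R
        in-R′ = Sum.map (tail u≢v) (tail w≢v) in-R

    composed′ : ∀ u w → u ∉ v ∷ R → w ∉ v ∷ R →
      mutate v s u w ≡ (paths b (v ∷ R) u w + b u w) ∸ (paths b (v ∷ R) w u + b w u)
    composed′ u w u∉ w∉ = begin
      mutate v s u w                                   ≡⟨ detour (λ u≡v → u∉ (here u≡v)) (λ w≡v → w∉ (here w≡v)) ⟩
      (s u w + p) ∸ (s w u + q)                        ≡⟨ cong₂ (λ x y → (x + p) ∸ (y + q))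
                                                                (composed u w (λ u∈ → u∉ (there u∈)) (λ w∈ → w∉ (there w∈)))
                                                                (composed w u (λ w∈ → w∉ (there w∈)) (λ u∈ → u∉ (there u∈))) ⟩
      ((X ∸ Y) + p) ∸ ((Y ∸ X) + q)                    ≡⟨ ∸-recompose X Y p q ⟩
      (X + p) ∸ (Y + q)                                ≡⟨ cong₂ _∸_ (absorb (paths b R u w) (b u w) p) (absorb (paths b R w u) (b w u) q) ⟩
      (paths b (v ∷ R) u w + b u w) ∸ (paths b (v ∷ R) w u + b w u) ∎
      where
      open ≡-Reasoning
      p = b u v * b v w
      q = b w v * b v u
      X = paths b R u w + b u w
      Y = paths b R w u + b w u
      absorb : ∀ P c r → (P + c) + r ≡ (r + P) + c
      absorb P c r = trans (+-comm (P + c) r) (sym (+-assoc r P c))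

  mutate-along : ∀ R → Unique R → Independent R → MutatedAlong R (foldr mutate b R)
  mutate-along []      _              _     = mutated-along-nothing
  mutate-along (v ∷ R) (v≢R ∷ unique) indep =
    mutated-along-step (All¬⇒¬Any v≢R) indep
      (mutate-along R unique (λ u∈R w∈R → indep (there u∈R) (there w∈R)))

colourClass : {n : ℕ} → (Fin n → Bool) → Bool → List (Fin n)
colourClass {n} ε c = filter (λ k → ε k Bool.≟ c) (allFin n)

SymmetricPaths : {n : ℕ} → Arrows n → (Fin n → Bool) → Bool → Set
SymmetricPaths {n} b ε c = ∀ (u w : Fin n) → ε u ≡ not c → ε w ≡ not c →
  paths b (colourClass ε c) u w ≡ paths b (colourClass ε c) w u

module _ {n : ℕ} (ε : Fin n → Bool) {c : Bool} where

  ∈-colourClass : ∀ {u} → ε u ≡ c → u ∈ colourClass ε c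
  ∈-colourClass {u} = ∈-filter⁺ (λ k → ε k Bool.≟ c) (∈-allFin u)

  colour-of-member : ∀ {u} → u ∈ colourClass ε c → ε u ≡ c
  colour-of-member u∈ = proj₂ (∈-filter⁻ (λ k → ε k Bool.≟ c) {xs = allFin n} u∈)

  ∉-colourClass : ∀ {u} → ε u ≡ not c → u ∉ colourClass ε c
  ∉-colourClass εu≡¬c u∈ = not-¬ (colour-of-member u∈) εu≡¬c

  colourClass-unique : Unique (colourClass ε c)
  colourClass-unique = filter⁺ (λ k → ε k Bool.≟ c) (allFin⁺ n)

  mutateColour-along-class : ∀ (b : Arrows n) → mutateColour ε c b ≡ foldr mutate b (colourClass ε c)
  mutateColour-along-class b = foldr-filter (λ k → ε k Bool.≟ c) mutate b (allFin n)

module Recurrence {n : ℕ} (b : Arrows n) (ε : Fin n → Bool) (quiver : IsQuiver b) (bipartite : IsBipartite b ε) where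

  open IndependentMutation b (proj₂ quiver)

  same-colour-no-arrow : ∀ {u w} → ε u ≡ ε w → b u w ≡ 0
  same-colour-no-arrow {u} {w} εu≡εw with b u w in eq
  ... | zero  = refl
  ... | suc _ = ⊥-elim (bipartite u w (subst (0 <_) (sym eq) z<s) εu≡εw)

  colourClass-independent : ∀ c → Independent (colourClass ε c)
  colourClass-independent c u∈ w∈ =
    same-colour-no-arrow (trans (colour-of-member ε u∈) (sym (colour-of-member ε w∈)))

  mutated-along-class : ∀ c → MutatedAlong (colourClass ε c) (mutateColour ε c b)
  mutated-along-class c =
    subst (MutatedAlong (colourClass ε c)) (sym (mutateColour-along-class ε b))
          (mutate-along (colourClass ε c) (colourClass-unique ε) (colourClass-independent c))

  off-class : ∀ c u w → ε u ≡ not c → ε w ≡ not c →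
    mutateColour ε c b u w ≡ paths b (colourClass ε c) u w ∸ paths b (colourClass ε c) w u
  off-class c u w εu εw = begin
    mutateColour ε c b u w             ≡⟨ composed u w (∉-colourClass ε εu) (∉-colourClass ε εw) ⟩
    (P u w + b u w) ∸ (P w u + b w u)  ≡⟨ cong₂ (λ x y → (P u w + x) ∸ (P w u + y))
                                                 (same-colour-no-arrow (trans εu (sym εw)))
                                                 (same-colour-no-arrow (trans εw (sym εu))) ⟩
    (P u w + 0) ∸ (P w u + 0)          ≡⟨ cong₂ _∸_ (+-identityʳ (P u w)) (+-identityʳ (P w u)) ⟩
    P u w ∸ P w u                      ∎
    where
    open ≡-Reasoning
    open MutatedAlong (mutated-along-class c)
    P = paths b (colourClass ε c)

  recurrent-at-colour : ∀ c → EqArrows (mutateColour ε c b) (opposite b) ⇔ SymmetricPaths b ε c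
  recurrent-at-colour c = mk⇔ to from
    where
    open MutatedAlong (mutated-along-class c)
    P = paths b (colourClass ε c)

    -- a symmetric pair of truncated differences vanishes both ways
    to : EqArrows (mutateColour ε c b) (opposite b) → SymmetricPaths b ε c
    to E u w εu εw = ∸-both-zero (vanish u w εu εw) (vanish w u εw εu)
      where
      vanish : ∀ u w → ε u ≡ not c → ε w ≡ not c → P u w ∸ P w u ≡ 0
      vanish u w εu εw = trans (sym (off-class c u w εu εw))
                               (trans (E u w) (same-colour-no-arrow (trans εw (sym εu))))

    from : SymmetricPaths b ε c → EqArrows (mutateColour ε c b) (opposite b)
    from S u w with ε u Bool.≟ c | ε w Bool.≟ c
    ... | yes εu | _      = reversed u w (inj₁ (∈-colourClass ε εu))
    ... | no _   | yes εw = reversed u w (inj₂ (∈-colourClass ε εw))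
    ... | no εu≢c | no εw≢c = begin
      mutateColour ε c b u w ≡⟨ off-class c u w εu εw ⟩
      P u w ∸ P w u          ≡⟨ cong (_∸ P w u) (S u w εu εw) ⟩
      P w u ∸ P w u          ≡⟨ n∸n≡0 (P w u) ⟩
      0                      ≡⟨ sym (same-colour-no-arrow (trans εw (sym εu))) ⟩
      b w u                  ∎
      where
      open ≡-Reasoning
      εu = ¬-not εu≢c
      εw = ¬-not εw≢c

  recurrent⇔symmetric-paths : Recurrent b ε ⇔ (SymmetricPaths b ε true × SymmetricPaths b ε false)
  recurrent⇔symmetric-paths = recurrent-at-colour true ×-⇔ recurrent-at-colour false

matMul-transpose : ∀ {n} (A B : Fin n → Fin n → ℕ) →
  (∀ u w → A u w ≡ A w u) → (∀ u w → B u w ≡ B w u) →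
  ∀ i j → matMul B A i j ≡ matMul A B j i
matMul-transpose {n} A B A-sym B-sym i j = cong sum (map-cong term (allFin n))
  where
  term : ∀ k → B i k * A k j ≡ A j k * B k i
  term k = trans (*-comm (B i k) (A k j)) (cong₂ _*_ (A-sym k j) (B-sym i k))

module Adjacency {n : ℕ} (b : Arrows n) (ε : Fin n → Bool) where

  Γ-sym : ∀ u w → adjΓ b ε u w ≡ adjΓ b ε w u
  Γ-sym u w = +-comm (edgesΓ b ε u w) (edgesΓ b ε w u)

  Δ-sym : ∀ u w → adjΔ b ε u w ≡ adjΔ b ε w u
  Δ-sym u w = +-comm (edgesΔ b ε u w) (edgesΔ b ε w u)

  ΓΔ : Fin n → Fin n → ℕ
  ΓΔ = matMul (adjΓ b ε) (adjΔ b ε)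

  term-white : ∀ {i j} k → ε i ≡ false → ε j ≡ false →
    adjΓ b ε i k * adjΔ b ε k j ≡ (if does (ε k Bool.≟ true) then b i k * b k j else 0)
  term-white {i} {j} k _ _ with ε i | ε j | ε k
  ... | false | false | true  = cong₂ _*_ (+-identityʳ (b i k)) (+-identityʳ (b k j))
  ... | false | false | false = refl

  term-black : ∀ {i j} k → ε i ≡ true → ε j ≡ true →
    adjΓ b ε i k * adjΔ b ε k j ≡ (if does (ε k Bool.≟ false) then b j k * b k i else 0)
  term-black {i} {j} k _ _ with ε i | ε j | ε k
  ... | true | true | false = *-comm (b k i) (b j k)
  ... | true | true | true  = refl

  term-mixed : ∀ {i j} k → ¬ ε i ≡ ε j → adjΓ b ε i k * adjΔ b ε k j ≡ 0
  term-mixed {i} {j} k εi≢εj with ε i | ε j | ε k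
  ... | false | false | _     = ⊥-elim (εi≢εj refl)
  ... | true  | true  | _     = ⊥-elim (εi≢εj refl)
  ... | false | true  | true  = *-zeroʳ (b i k + 0)
  ... | false | true  | false = refl
  ... | true  | false | true  = refl
  ... | true  | false | false = *-zeroʳ (b k i)

  ΓΔ-white : ∀ {i j} → ε i ≡ false → ε j ≡ false → ΓΔ i j ≡ paths b (colourClass ε true) i j
  ΓΔ-white {i} {j} εi εj =
    trans (cong sum (map-cong (λ k → term-white k εi εj) (allFin n)))
          (sym (sum-filter (λ k → ε k Bool.≟ true) (λ k → b i k * b k j) (allFin n)))

  ΓΔ-black : ∀ {i j} → ε i ≡ true → ε j ≡ true → ΓΔ i j ≡ paths b (colourClass ε false) j i
  ΓΔ-black {i} {j} εi εj =
    trans (cong sum (map-cong (λ k → term-black k εi εj) (allFin n)))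
          (sym (sum-filter (λ k → ε k Bool.≟ false) (λ k → b j k * b k i) (allFin n)))

  ΓΔ-mixed : ∀ {i j} → ¬ ε i ≡ ε j → ΓΔ i j ≡ 0
  ΓΔ-mixed {i} {j} εi≢εj = sum-vanishes _ (allFin n) (λ {k} _ → term-mixed k εi≢εj)

  commute⇔ΓΔ-symmetric : Commute (adjΓ b ε) (adjΔ b ε) ⇔ (∀ i j → ΓΔ i j ≡ ΓΔ j i)
  commute⇔ΓΔ-symmetric = mk⇔
    (λ C i j → trans (C i j) (transpose i j))
    (λ S i j → trans (S i j) (sym (transpose i j)))
    where
    transpose : ∀ i j → matMul (adjΔ b ε) (adjΓ b ε) i j ≡ ΓΔ j i
    transpose = matMul-transpose (adjΓ b ε) (adjΔ b ε) Γ-sym Δ-sym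

  ΓΔ-symmetric⇔symmetric-paths :
    (∀ i j → ΓΔ i j ≡ ΓΔ j i) ⇔ (SymmetricPaths b ε true × SymmetricPaths b ε false)
  ΓΔ-symmetric⇔symmetric-paths = mk⇔ to from
    where
    to : (∀ i j → ΓΔ i j ≡ ΓΔ j i) → SymmetricPaths b ε true × SymmetricPaths b ε false
    to S = (λ u w εu εw → trans (sym (ΓΔ-white εu εw)) (trans (S u w) (ΓΔ-white εw εu)))
         , (λ u w εu εw → trans (sym (ΓΔ-black εw εu)) (trans (S w u) (ΓΔ-black εu εw)))

    from : SymmetricPaths b ε true × SymmetricPaths b ε false → ∀ i j → ΓΔ i j ≡ ΓΔ j i
    from (S● , S○) i j = by-colours (ε i) (ε j) refl refl
      where
      mixed : ∀ {x y} → ε i ≡ x → ε j ≡ y → ¬ x ≡ y → ΓΔ i j ≡ ΓΔ j i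
      mixed εi εj x≢y = trans (ΓΔ-mixed εi≢εj) (sym (ΓΔ-mixed (λ εj≡εi → εi≢εj (sym εj≡εi))))
        where
        εi≢εj : ¬ ε i ≡ ε j
        εi≢εj εi≡εj = x≢y (trans (sym εi) (trans εi≡εj εj))

      by-colours : ∀ x y → ε i ≡ x → ε j ≡ y → ΓΔ i j ≡ ΓΔ j i
      by-colours false false εi εj = trans (ΓΔ-white εi εj) (trans (S● i j εi εj) (sym (ΓΔ-white εj εi)))
      by-colours true  true  εi εj = trans (ΓΔ-black εi εj) (trans (S○ j i εj εi) (sym (ΓΔ-black εj εi)))
      by-colours false true  εi εj = mixed εi εj (λ ())
      by-colours true  false εi εj = mixed εi εj (λ ())

corollary2p3 : (n : ℕ) (b : Arrows n) (ε : Fin n → Bool) →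
    IsQuiver b → IsBipartite b ε →
    (Recurrent b ε ⇔ Commute (adjΓ b ε) (adjΔ b ε))
corollary2p3 n b ε quiver bipartite =
  ⇔.trans (Recurrence.recurrent⇔symmetric-paths b ε quiver bipartite)
    (⇔.sym (⇔.trans (Adjacency.commute⇔ΓΔ-symmetric b ε) (Adjacency.ΓΔ-symmetric⇔symmetric-paths b ε)))
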